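{- Let $G$ be a snark and let $\tilde G$ be a snark obtained from $G$ by a proper superposition which replaces each vertex $v$ of $G$ with a supervertex $V_v$ and each edge $e$ of $G$ with a proper superedge $E_e$. If $\{u,v\}$ is a removable pair of vertices of $G$, then for every vertex $\tilde u$ of $V_u$ and every vertex $\tilde v$ of $V_v$, the pair $\{\tilde u,\tilde v\}$ is a removable pair of vertices of $\tilde G$.
   Context: A snark is a connected cubic graph with chromatic index $4$. A pair of distinct vertices $\{x,y\}$ of a cubic graph $H$ is removable if the graph obtained by deleting $x$ and $y$ is not $3$-edge-colourable (equivalently, the $6$-pole $H-(x,y)$ obtained by deleting them and keeping their incident edges as dangling edges is not colourable). A multipole is a cubic graph that may contain dangling and isolated edges; free edge ends are semiedges, partitioned into ordered connectors. A junction of two connectors of equal width joins their semiedges pairwise into edges. Let $\mathbb{K}=\mathbb{Z}_2\times\mathbb{Z}_2\setminus\{(0,0)\}$; a colouring of a multipole assigns elements of $\mathbb{K}$ to edges so that the three edge ends at each vertex sum to $0$; the flow through a connector is the sum of the colours of its semiedges. Superposition: given a connected cubic base graph $G$, each vertex $v$ is replaced by a supervertex $V_v$, a multipole with three connectors corresponding to the three edge-ends at $v$, and each edge $e$ by a superedge $E_e$, a multipole with two connectors corresponding to the two ends of $e$; then, for each incidence of an end of an edge $e$ with a vertex $v$ in $G$, the corresponding connectors of $E_e$ and $V_v$ (required to have equal width) are joined, yielding a cubic graph. A superedge is proper if under every colouring of it the flow through each of its connectors is nonzero. A superposition is proper if every superedge used is proper. -}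

module Defs where

open import Data.Nat using (ℕ; zero; suc)
open import Data.Fin using (Fin; zero; suc; toℕ)
open import Data.Bool using (Bool; true; false; _xor_)
open import Data.Product using (Σ; _×_; _,_; proj₁; proj₂; ∃)
open import Data.Sum using (_⊎_; inj₁; inj₂)
open import Relation.Binary.PropositionalEquality using (_≡_; _≢_)
open import Relation.Binary.Construct.Closure.ReflexiveTransitive using (Star)
open import Relation.Nullary using (¬_)
open import Function.Bundles using (_↔_; _⇔_; Inverse)

Z22 : Set
Z22 = Bool × Bool

0ᶻ : Z22
0ᶻ = (false , false)

_⊕_ : Z22 → Z22 → Z22
(a , b) ⊕ (c , d) = (a xor c , b xor d)

K : Set
K = Σ Z22 (λ x → x ≢ 0ᶻ)

sumZ : (n : ℕ) → (Fin n → Z22) → Z22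
sumZ zero    f = 0ᶻ
sumZ (suc n) f = f zero ⊕ sumZ n (λ i → f (suc i))

-- Every edge end is attached either to a vertex-end or is a free end
-- (a semiedge); this incidence is a bijection.  Hence dangling edges
-- (one free end) and isolated edges (two free ends) are allowed.

VEnd : ℕ → Set
VEnd n = Fin n × Fin 3

Semi : (c : ℕ) → (Fin c → ℕ) → Set
Semi c w = Σ (Fin c) (λ i → Fin (w i))

record Multipole (c : ℕ) : Set where
  field
    nV    : ℕ
    nE    : ℕ
    width : Fin c → ℕ
    inc   : (Fin nE × Fin 2) ↔ (VEnd nV ⊎ Semi c width)

open Multipole public

End : ∀ {c} → Multipole c → Set
End {c} M = VEnd (nV M) ⊎ Semi c (width M)

flip2 : Fin 2 → Fin 2
flip2 zero       = suc zero
flip2 (suc zero) = zero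

edgeAt : ∀ {c} (M : Multipole c) → End M → Fin (nE M)
edgeAt M x = proj₁ (Inverse.from (inc M) x)

other : ∀ {c} (M : Multipole c) → End M → End M
other M x = Inverse.to (inc M) (proj₁ (Inverse.from (inc M) x) , flip2 (proj₂ (Inverse.from (inc M) x)))

VertexOK : ∀ {c} (M : Multipole c) → (Fin (nE M) → K) → Fin (nV M) → Set
VertexOK M col v = sumZ 3 (λ i → proj₁ (col (edgeAt M (inj₁ (v , i))))) ≡ 0ᶻ

IsColouring : ∀ {c} (M : Multipole c) → (Fin (nE M) → K) → Set
IsColouring M col = ∀ v → VertexOK M col v

Colourable : ∀ {c} → Multipole c → Set
Colourable M = ∃ λ col → IsColouring M col

flow : ∀ {c} (M : Multipole c) → (Fin (nE M) → K) → Fin c → Z22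
flow M col i = sumZ (width M i) (λ j → proj₁ (col (edgeAt M (inj₂ (i , j)))))

ProperSuperedge : Multipole 2 → Set
ProperSuperedge M = ∀ col → IsColouring M col → ∀ i → flow M col i ≢ 0ᶻ

CubicGraph : Set
CubicGraph = Multipole 0

Adjacent : (H : CubicGraph) → Fin (nV H) → Fin (nV H) → Set
Adjacent H x y = ∃ λ i → ∃ λ j → other H (inj₁ (x , i)) ≡ inj₁ (y , j)

Connected : CubicGraph → Set
Connected H = ∀ x y → Star (Adjacent H) x y

Snark : CubicGraph → Set
Snark H = Connected H × ¬ Colourable H

-- colourings of the 6-pole H - (x , y): Kirchhoff condition at every
-- vertex except x and y (the edges at x, y become dangling/isolated edges)
Colourable-6pole : (H : CubicGraph) → Fin (nV H) → Fin (nV H) → Set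
Colourable-6pole H x y =
  ∃ λ col → ∀ w → w ≢ x → w ≢ y → VertexOK H col w

Removable : (H : CubicGraph) → Fin (nV H) → Fin (nV H) → Set
Removable H x y = x ≢ y × ¬ Colourable-6pole H x y

module Superpose (G : CubicGraph)
                 (Vs : Fin (nV G) → Multipole 3)
                 (Es : Fin (nE G) → Multipole 2) where

  Piece : Set
  Piece = Fin (nV G) ⊎ Fin (nE G)

  pc : Piece → ℕ
  pc (inj₁ _) = 3
  pc (inj₂ _) = 2

  piece : (p : Piece) → Multipole (pc p)
  piece (inj₁ v) = Vs v
  piece (inj₂ e) = Es e

  PVert : Set
  PVert = Σ Piece (λ p → Fin (nV (piece p)))

  PSemi : Piece → Set
  PSemi p = Semi (pc p) (width (piece p))

  data Joined : (p : Piece) → PSemi p → (q : Piece) → PSemi q → Set where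
    ev : ∀ e k j v i j' → Inverse.to (inc G) (e , k) ≡ inj₁ (v , i) → toℕ j ≡ toℕ j' →
         Joined (inj₂ e) (k , j) (inj₁ v) (i , j')
    ve : ∀ e k j v i j' → Inverse.to (inc G) (e , k) ≡ inj₁ (v , i) → toℕ j ≡ toℕ j' →
         Joined (inj₁ v) (i , j') (inj₂ e) (k , j)

  data Trace : (p : Piece) → End (piece p) → PVert → Fin 3 → Set where
    stop : ∀ {p x w i} → other (piece p) x ≡ inj₁ (w , i) → Trace p x (p , w) i
    step : ∀ {p x s q t b i} → other (piece p) x ≡ inj₂ s → Joined p s q t →
           Trace q (inj₂ t) b i → Trace p x b i

  Chain : PVert → Fin 3 → PVert → Fin 3 → Set
  Chain (p , w) i b j = Trace p (inj₁ (w , i)) b j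

  -- H is (isomorphic to) the superposition of G with supervertices Vs and
  -- superedges Es: ψ identifies the vertices of H with the vertices of the
  -- pieces, π x identifies the vertex-ends of x with those of ψ x, and two
  -- vertex-ends of H are the ends of a common edge iff they are connected
  -- through the glued pieces.
  record IsSuperposition (H : CubicGraph) : Set where
    field
      widths : ∀ e k v i → Inverse.to (inc G) (e , k) ≡ inj₁ (v , i) →
               width (Es e) k ≡ width (Vs v) i
      ψ      : Fin (nV H) ↔ PVert
      π      : Fin (nV H) → Fin 3 ↔ Fin 3
      edges  : ∀ x i y j →
               (other H (inj₁ (x , i)) ≡ inj₁ (y , j)) ⇔
               Chain (Inverse.to ψ x) (Inverse.to (π x) i) (Inverse.to ψ y) (Inverse.to (π y) j)

open Superpose public using (IsSuperposition)

module Submission where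

-- A colouring of H − (x̃, ỹ) is pulled back to the pieces: every edge of a piece lies on a chain of
-- piece edges glued at junctions, which is either an edge of H, whose colour it inherits, or a closed
-- cycle, coloured arbitrarily.  This colours every superedge and every supervertex other than V_u, V_v.
-- In a coloured multipole the connector flows sum to zero, so the two flows through a superedge agree,
-- are nonzero by properness, and equal the flows through the adjacent supervertex connectors.
-- Colouring each edge e of G by the flow through E_e therefore satisfies Kirchhoff's law at every
-- vertex other than u and v, contradicting the removability of {u, v}.
-- Chains are followed by a walk with fuel: the length of the longest chain starting at a vertex of H.

open import Defs
open import Algebra.Bundles using (CommutativeMonoid)
import Algebra.Properties.CommutativeMonoid.Sum as CommutativeMonoidSum
open import Data.Bool using (true; false)
open import Data.Bool.Properties using (xor-assoc; xor-comm; xor-identityʳ; xor-same)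
open import Data.Fin using (Fin; zero; suc; cast; splitAt)
open import Data.Fin.Properties using (+↔⊎; toℕ-cast; toℕ-injective; cast-is-id)
open import Data.Nat using (ℕ; zero; suc; _+_; _≤_; _⊔_)
open import Data.Nat.Properties using (+-comm; ≤-trans; m≤m⊔n; m≤n⊔m; m≤n⇒∃[o]m+o≡n)
open import Data.Product using (Σ; _×_; _,_; proj₁; proj₂; ∃)
open import Data.Sum using (_⊎_; inj₁; inj₂; [_,_]′)
open import Data.Sum.Properties using (inj₁-injective)
import Data.Sum as Sum
open import Data.Sum.Function.Propositional using (_⊎-cong_)
open import Function.Base using (_∘_; const)
open import Function.Bundles using (_↔_; Inverse; Injection; Equivalence; mk↔ₛ′)
open import Function.Properties.Inverse using (↔⇒↣)
open import Function.Construct.Composition using (_↔-∘_)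
open import Function.Construct.Identity using (↔-id)
open import Function.Construct.Symmetry using (↔-sym)
open import Relation.Binary.PropositionalEquality

⊕-assoc : ∀ x y z → (x ⊕ y) ⊕ z ≡ x ⊕ (y ⊕ z)
⊕-assoc (a , b) (c , d) (e , f) = cong₂ _,_ (xor-assoc a c e) (xor-assoc b d f)

⊕-comm : ∀ x y → x ⊕ y ≡ y ⊕ x
⊕-comm (a , b) (c , d) = cong₂ _,_ (xor-comm a c) (xor-comm b d)

⊕-identityˡ : ∀ x → 0ᶻ ⊕ x ≡ x
⊕-identityˡ _ = refl

⊕-identityʳ : ∀ x → x ⊕ 0ᶻ ≡ x
⊕-identityʳ (a , b) = cong₂ _,_ (xor-identityʳ a) (xor-identityʳ b)

⊕-self : ∀ x → x ⊕ x ≡ 0ᶻ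
⊕-self (a , b) = cong₂ _,_ (xor-same a) (xor-same b)

⊕-cancel : ∀ {x y} → x ⊕ y ≡ 0ᶻ → x ≡ y
⊕-cancel {x} {y} x⊕y≡0 = begin
  x            ≡⟨ ⊕-identityʳ x ⟨
  x ⊕ 0ᶻ       ≡⟨ cong (x ⊕_) (⊕-self y) ⟨
  x ⊕ (y ⊕ y)  ≡⟨ ⊕-assoc x y y ⟨
  (x ⊕ y) ⊕ y  ≡⟨ cong (_⊕ y) x⊕y≡0 ⟩
  y            ∎
  where open ≡-Reasoning

⊕-commutativeMonoid : CommutativeMonoid _ _
⊕-commutativeMonoid = record
  { Carrier = Z22 ; _≈_ = _≡_ ; _∙_ = _⊕_ ; ε = 0ᶻ
  ; isCommutativeMonoid = record
    { isMonoid = record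
      { isSemigroup = record
        { isMagma = record { isEquivalence = isEquivalence ; ∙-cong = cong₂ _⊕_ }
        ; assoc = ⊕-assoc }
      ; identity = ⊕-identityˡ , ⊕-identityʳ }
    ; comm = ⊕-comm } }

module ⊕-Sum = CommutativeMonoidSum ⊕-commutativeMonoid

sumZ-sum : ∀ n (f : Fin n → Z22) → sumZ n f ≡ ⊕-Sum.sum f
sumZ-sum zero    f = refl
sumZ-sum (suc n) f = cong (f zero ⊕_) (sumZ-sum n (f ∘ suc))

sumZ-cong : ∀ n {f g : Fin n → Z22} → (∀ i → f i ≡ g i) → sumZ n f ≡ sumZ n g
sumZ-cong zero    f≗g = refl
sumZ-cong (suc n) f≗g = cong₂ _⊕_ (f≗g zero) (sumZ-cong n (f≗g ∘ suc))

sumZ-zero : ∀ n {f : Fin n → Z22} → (∀ i → f i ≡ 0ᶻ) → sumZ n f ≡ 0ᶻ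
sumZ-zero zero    f≗0 = refl
sumZ-zero (suc n) f≗0 = cong₂ _⊕_ (f≗0 zero) (sumZ-zero n (f≗0 ∘ suc))

sumZ-permute : ∀ {m n} (σ : Fin m ↔ Fin n) (f : Fin n → Z22) →
               sumZ n f ≡ sumZ m (f ∘ Inverse.to σ)
sumZ-permute {m} {n} σ f = begin
  sumZ n f                    ≡⟨ sumZ-sum n f ⟩
  ⊕-Sum.sum f                 ≡⟨ ⊕-Sum.sum-permute f σ ⟩
  ⊕-Sum.sum (f ∘ Inverse.to σ) ≡⟨ sumZ-sum m _ ⟨
  sumZ m (f ∘ Inverse.to σ)   ∎
  where open ≡-Reasoning

sumZ-cast : ∀ {m n} (eq : m ≡ n) (f : Fin n → Z22) → sumZ m (f ∘ cast eq) ≡ sumZ n f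
sumZ-cast refl f = sumZ-cong _ (cong f ∘ cast-is-id refl)

sumZ-splitAt : ∀ m n (g : Fin m ⊎ Fin n → Z22) →
               sumZ (m + n) (g ∘ splitAt m) ≡ sumZ m (g ∘ inj₁) ⊕ sumZ n (g ∘ inj₂)
sumZ-splitAt zero    n g = refl
sumZ-splitAt (suc m) n g = begin
  g (inj₁ zero) ⊕ sumZ (m + n) (g ∘ Sum.map₁ suc ∘ splitAt m)
    ≡⟨ cong (g (inj₁ zero) ⊕_) (sumZ-splitAt m n (g ∘ Sum.map₁ suc)) ⟩
  g (inj₁ zero) ⊕ (sumZ m (g ∘ inj₁ ∘ suc) ⊕ sumZ n (g ∘ inj₂))
    ≡⟨ ⊕-assoc (g (inj₁ zero)) (sumZ m (g ∘ inj₁ ∘ suc)) (sumZ n (g ∘ inj₂)) ⟨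
  sumZ (suc m) (g ∘ inj₁) ⊕ sumZ n (g ∘ inj₂) ∎
  where open ≡-Reasoning

∑⟨_⟩ : ∀ {n} {A : Set} → Fin n ↔ A → (A → Z22) → Z22
∑⟨_⟩ {n} σ g = sumZ n (g ∘ Inverse.to σ)

∑-enumeration-irrelevant : ∀ {m n} {A : Set} (σ : Fin m ↔ A) (τ : Fin n ↔ A) (g : A → Z22) →
                           ∑⟨ σ ⟩ g ≡ ∑⟨ τ ⟩ g
∑-enumeration-irrelevant σ τ g = sym (begin
  ∑⟨ τ ⟩ g
    ≡⟨ sumZ-permute (↔-sym τ ↔-∘ σ) (g ∘ Inverse.to τ) ⟩
  ∑⟨ σ ⟩ (g ∘ Inverse.to τ ∘ Inverse.from τ)
    ≡⟨ sumZ-cong _ (cong g ∘ Inverse.strictlyInverseˡ τ ∘ Inverse.to σ) ⟩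
  ∑⟨ σ ⟩ g ∎)
  where open ≡-Reasoning

widthSum : (c : ℕ) → (Fin c → ℕ) → ℕ
widthSum zero    w = 0
widthSum (suc c) w = w zero + widthSum c (w ∘ suc)

semi-suc : ∀ {c} {w : Fin (suc c) → ℕ} → Semi c (w ∘ suc) → Semi (suc c) w
semi-suc (i , j) = suc i , j

Semi-suc-↔ : ∀ {c} (w : Fin (suc c) → ℕ) → (Fin (w zero) ⊎ Semi c (w ∘ suc)) ↔ Semi (suc c) w
Semi-suc-↔ {c} w = mk↔ₛ′ [ (zero ,_) , semi-suc ]′ split split-inverseˡ split-inverseʳ
  where
  split : Semi (suc c) w → Fin (w zero) ⊎ Semi c (w ∘ suc)
  split (zero  , j) = inj₁ j
  split (suc i , j) = inj₂ (i , j)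
  split-inverseˡ : ∀ s → [ (zero ,_) , semi-suc ]′ (split s) ≡ s
  split-inverseˡ (zero  , j) = refl
  split-inverseˡ (suc i , j) = refl
  split-inverseʳ : ∀ x → split ([ (zero ,_) , semi-suc ]′ x) ≡ x
  split-inverseʳ (inj₁ j) = refl
  split-inverseʳ (inj₂ s) = refl

Semi-↔ : ∀ c (w : Fin c → ℕ) → Fin (widthSum c w) ↔ Semi c w
Semi-↔ zero    w = mk↔ₛ′ (λ ()) (λ ()) (λ ()) (λ ())
Semi-↔ (suc c) w = Semi-suc-↔ w ↔-∘ ((↔-id _ ⊎-cong Semi-↔ c (w ∘ suc)) ↔-∘ +↔⊎)

∑-Semi : ∀ c (w : Fin c → ℕ) (g : Semi c w → Z22) →
         ∑⟨ Semi-↔ c w ⟩ g ≡ sumZ c (λ i → sumZ (w i) (λ j → g (i , j)))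
∑-Semi zero    w g = refl
∑-Semi (suc c) w g = begin
  sumZ (w zero + widthSum c (w ∘ suc)) (g ∘ Inverse.to (Semi-↔ (suc c) w))
    ≡⟨ sumZ-splitAt (w zero) (widthSum c (w ∘ suc))
                    (g ∘ Inverse.to (Semi-suc-↔ w) ∘ Sum.map₂ (Inverse.to (Semi-↔ c (w ∘ suc)))) ⟩
  sumZ (w zero) (g ∘ (zero ,_)) ⊕ ∑⟨ Semi-↔ c (w ∘ suc) ⟩ (g ∘ semi-suc)
    ≡⟨ cong (sumZ (w zero) (g ∘ (zero ,_)) ⊕_) (∑-Semi c (w ∘ suc) (g ∘ semi-suc)) ⟩
  sumZ (suc c) (λ i → sumZ (w i) (λ j → g (i , j))) ∎
  where open ≡-Reasoning

enumerate⊎ : ∀ {m n} {A B : Set} → Fin m ↔ A → Fin n ↔ B → Fin (m + n) ↔ (A ⊎ B)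
enumerate⊎ σ τ = (σ ⊎-cong τ) ↔-∘ +↔⊎

∑-⊎ : ∀ {m n} {A B : Set} (σ : Fin m ↔ A) (τ : Fin n ↔ B) (g : A ⊎ B → Z22) →
      ∑⟨ enumerate⊎ σ τ ⟩ g ≡ ∑⟨ σ ⟩ (g ∘ inj₁) ⊕ ∑⟨ τ ⟩ (g ∘ inj₂)
∑-⊎ {m} {n} σ τ g = sumZ-splitAt m n (g ∘ Sum.map (Inverse.to σ) (Inverse.to τ))

edgeAt-to : ∀ {c} (M : Multipole c) e k → edgeAt M (Inverse.to (inc M) (e , k)) ≡ e
edgeAt-to M e k = cong proj₁ (Inverse.strictlyInverseʳ (inc M) (e , k))

other-to : ∀ {c} (M : Multipole c) e k → other M (Inverse.to (inc M) (e , k)) ≡ Inverse.to (inc M) (e , flip2 k)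
other-to M e k =
  cong (λ a → Inverse.to (inc M) (proj₁ a , flip2 (proj₂ a))) (Inverse.strictlyInverseʳ (inc M) (e , k))

other-involutive : ∀ {c} (M : Multipole c) x → other M (other M x) ≡ x
other-involutive M x = begin
  other M (Inverse.to (inc M) (e , flip2 k))  ≡⟨ other-to M e (flip2 k) ⟩
  Inverse.to (inc M) (e , flip2 (flip2 k))    ≡⟨ cong (λ k → Inverse.to (inc M) (e , k)) (flip2-involutive k) ⟩
  Inverse.to (inc M) (e , k)                  ≡⟨ Inverse.strictlyInverseˡ (inc M) x ⟩
  x                                           ∎
  where
  open ≡-Reasoning
  e = proj₁ (Inverse.from (inc M) x)
  k = proj₂ (Inverse.from (inc M) x)
  flip2-involutive : ∀ k → flip2 (flip2 k) ≡ k
  flip2-involutive zero       = refl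
  flip2-involutive (suc zero) = refl

edgeAt-other : ∀ {c} (M : Multipole c) x → edgeAt M (other M x) ≡ edgeAt M x
edgeAt-other M x = edgeAt-to M (edgeAt M x) (flip2 (proj₂ (Inverse.from (inc M) x)))

module _ {c} (M : Multipole c) {A : Set} (κ : End M → A) (κ-other : ∀ x → κ (other M x) ≡ κ x) where

  edgeColouring : Fin (nE M) → A
  edgeColouring e = κ (Inverse.to (inc M) (e , zero))

  edgeColouring-edgeAt : ∀ x → edgeColouring (edgeAt M x) ≡ κ x
  edgeColouring-edgeAt x = begin
    κ (Inverse.to (inc M) (e , zero)) ≡⟨ same-at-both-ends k ⟩
    κ (Inverse.to (inc M) (e , k))    ≡⟨ cong κ (Inverse.strictlyInverseˡ (inc M) x) ⟩
    κ x                               ∎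
    where
    open ≡-Reasoning
    e = proj₁ (Inverse.from (inc M) x)
    k = proj₂ (Inverse.from (inc M) x)
    same-at-both-ends : ∀ k → κ (Inverse.to (inc M) (e , zero)) ≡ κ (Inverse.to (inc M) (e , k))
    same-at-both-ends zero       = refl
    same-at-both-ends (suc zero) = trans (cong κ (sym (other-to M e (suc zero)))) (κ-other _)

end-at-vertex : (H : CubicGraph) (x : End H) → ∃ λ vi → x ≡ inj₁ vi
end-at-vertex H (inj₁ vi)       = vi , refl
end-at-vertex H (inj₂ (() , _))

-- Every edge has two ends, so in Z₂ × Z₂ the colours of all edge ends cancel;
-- grouping the ends instead by vertices and connectors gives the claim.
flow-parity : ∀ {c} (M : Multipole c) col → IsColouring M col → sumZ c (flow M col) ≡ 0ᶻ
flow-parity {c} M col isColouring = begin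
  sumZ c (flow M col)
    ≡⟨ cong (_⊕ sumZ c (flow M col)) (sumZ-zero (nV M) isColouring) ⟨
  sumZ (nV M) (λ v → sumZ 3 (λ i → colourAt (inj₁ (v , i)))) ⊕ sumZ c (flow M col)
    ≡⟨ cong₂ _⊕_ (∑-Semi (nV M) (λ _ → 3) (colourAt ∘ inj₁))
                 (∑-Semi c (width M) (colourAt ∘ inj₂)) ⟨
  ∑⟨ vertexEnds ⟩ (colourAt ∘ inj₁) ⊕ ∑⟨ semiedges ⟩ (colourAt ∘ inj₂)
    ≡⟨ ∑-⊎ vertexEnds semiedges colourAt ⟨
  ∑⟨ enumerate⊎ vertexEnds semiedges ⟩ colourAt
    ≡⟨ ∑-enumeration-irrelevant (enumerate⊎ vertexEnds semiedges) (inc M ↔-∘ edgeEnds) colourAt ⟩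
  ∑⟨ inc M ↔-∘ edgeEnds ⟩ colourAt
    ≡⟨ ∑-Semi (nE M) (λ _ → 2) (colourAt ∘ Inverse.to (inc M)) ⟩
  sumZ (nE M) (λ e → sumZ 2 (λ k → colourAt (Inverse.to (inc M) (e , k))))
    ≡⟨ sumZ-zero (nE M) edge-cancels ⟩
  0ᶻ ∎
  where
  open ≡-Reasoning
  -- VEnd n = Fin n × Fin 3 and Fin n × Fin 2 are Semi types of constant width.
  vertexEnds = Semi-↔ (nV M) (λ _ → 3)
  semiedges  = Semi-↔ c (width M)
  edgeEnds   = Semi-↔ (nE M) (λ _ → 2)
  colourAt : End M → Z22
  colourAt x = proj₁ (col (edgeAt M x))
  edge-cancels : ∀ e → sumZ 2 (λ k → colourAt (Inverse.to (inc M) (e , k))) ≡ 0ᶻ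
  edge-cancels e = begin
    colourAt (Inverse.to (inc M) (e , zero)) ⊕ (colourAt (Inverse.to (inc M) (e , suc zero)) ⊕ 0ᶻ)
      ≡⟨ cong₂ (λ a b → proj₁ (col a) ⊕ (proj₁ (col b) ⊕ 0ᶻ))
               (edgeAt-to M e zero) (edgeAt-to M e (suc zero)) ⟩
    proj₁ (col e) ⊕ (proj₁ (col e) ⊕ 0ᶻ)
      ≡⟨ cong (proj₁ (col e) ⊕_) (⊕-identityʳ (proj₁ (col e))) ⟩
    proj₁ (col e) ⊕ proj₁ (col e)
      ≡⟨ ⊕-self (proj₁ (col e)) ⟩
    0ᶻ ∎

flow-parity-2 : ∀ (M : Multipole 2) col → IsColouring M col → flow M col zero ≡ flow M col (suc zero)
flow-parity-2 M col isColouring = ⊕-cancel (begin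
  flow M col zero ⊕ flow M col (suc zero)          ≡⟨ cong (flow M col zero ⊕_) (⊕-identityʳ _) ⟨
  flow M col zero ⊕ (flow M col (suc zero) ⊕ 0ᶻ)  ≡⟨ flow-parity M col isColouring ⟩
  0ᶻ                                              ∎)
  where open ≡-Reasoning

bounded : ∀ n (f : Fin n → ℕ) → ∃ λ B → ∀ i → f i ≤ B
bounded zero    f = 0 , λ ()
bounded (suc n) f = f zero ⊔ B , f≤B
  where
  B = proj₁ (bounded n (f ∘ suc))
  f-suc≤B = proj₂ (bounded n (f ∘ suc))
  f≤B : ∀ i → f i ≤ f zero ⊔ B
  f≤B zero    = m≤m⊔n (f zero) B
  f≤B (suc i) = ≤-trans (f-suc≤B i) (m≤n⊔m (f zero) B)

bounded-↔ : ∀ {n} {A : Set} → Fin n ↔ A → (f : A → ℕ) → ∃ λ B → ∀ a → f a ≤ B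
bounded-↔ {n} σ f =
  B , λ a → subst (λ a → f a ≤ B) (Inverse.strictlyInverseˡ σ a) (f∘σ≤B (Inverse.from σ a))
  where
  B = proj₁ (bounded n (f ∘ Inverse.to σ))
  f∘σ≤B = proj₂ (bounded n (f ∘ Inverse.to σ))

module Tracing {Pos R : Set} (next : Pos → R ⊎ Pos) where

  advance : R ⊎ Pos → R ⊎ Pos
  advance (inj₁ r) = inj₁ r
  advance (inj₂ z) = next z

  iterate : ℕ → R ⊎ Pos → R ⊎ Pos
  iterate zero    s = s
  iterate (suc n) s = iterate n (advance s)

  iterate-+ : ∀ m n s → iterate (m + n) s ≡ iterate n (iterate m s)
  iterate-+ zero    n s = refl
  iterate-+ (suc m) n s = iterate-+ m n (advance s)

  iterate-comm : ∀ m n s → iterate n (iterate m s) ≡ iterate m (iterate n s)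
  iterate-comm m n s = begin
    iterate n (iterate m s) ≡⟨ iterate-+ m n s ⟨
    iterate (m + n) s       ≡⟨ cong (λ k → iterate k s) (+-comm m n) ⟩
    iterate (n + m) s       ≡⟨ iterate-+ n m s ⟩
    iterate m (iterate n s) ∎
    where open ≡-Reasoning

  iterate-inj₁ : ∀ n r → iterate n (inj₁ r) ≡ inj₁ r
  iterate-inj₁ zero    r = refl
  iterate-inj₁ (suc n) r = iterate-inj₁ n r

  iterate-mono : ∀ {m n s r} → m ≤ n → iterate m s ≡ inj₁ r → iterate n s ≡ inj₁ r
  iterate-mono {m} {s = s} {r} m≤n ends with o , refl ← m≤n⇒∃[o]m+o≡n m≤n = begin
    iterate (m + o) s        ≡⟨ iterate-+ m o s ⟩
    iterate o (iterate m s)  ≡⟨ cong (iterate o) ends ⟩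
    iterate o (inj₁ r)       ≡⟨ iterate-inj₁ o r ⟩
    inj₁ r                   ∎
    where open ≡-Reasoning

  Ends : Pos → R → Set
  Ends z r = ∃ λ n → iterate n (inj₂ z) ≡ inj₁ r

  Ends-functional : ∀ {z r r′} → Ends z r → Ends z r′ → r ≡ r′
  Ends-functional {z} {r} {r′} (m , ends) (n , ends′) = inj₁-injective (begin
    inj₁ r                      ≡⟨ iterate-inj₁ n r ⟨
    iterate n (inj₁ r)          ≡⟨ cong (iterate n) ends ⟨
    iterate n (iterate m (inj₂ z)) ≡⟨ iterate-comm m n (inj₂ z) ⟩
    iterate m (iterate n (inj₂ z)) ≡⟨ cong (iterate m) ends′ ⟩
    iterate m (inj₁ r′)         ≡⟨ iterate-inj₁ m r′ ⟩
    inj₁ r′                     ∎)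
    where open ≡-Reasoning

  Ends-next⁺ : ∀ {z z′ r} → next z ≡ inj₂ z′ → Ends z′ r → Ends z r
  Ends-next⁺ eq (n , ends) = suc n , trans (cong (iterate n) eq) ends

  Ends-next⁻ : ∀ {z z′ r} → next z ≡ inj₂ z′ → Ends z r → Ends z′ r
  Ends-next⁻ eq (zero  , ())
  Ends-next⁻ eq (suc n , ends) = n , trans (cong (iterate n) (sym eq)) ends

  module Reversible (opposite : Pos → Pos) (opposite-involutive : ∀ z → opposite (opposite z) ≡ z)
                    (start : R → Pos)
                    (next-final : ∀ {z r} → next z ≡ inj₁ r → opposite z ≡ start r)
                    (next-reverse : ∀ {z z′} → next z ≡ inj₂ z′ → next (opposite z′) ≡ inj₂ (opposite z)) where

    Reached : R → Pos → Set
    Reached r z = ∃ λ m → iterate m (inj₂ (start r)) ≡ inj₂ z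

    Ends-reverse : ∀ {z r} → Ends z r → Reached r (opposite z)
    Ends-reverse (n , ends) = reverse n ends
      where
      reverse : ∀ n {z r} → iterate n (inj₂ z) ≡ inj₁ r → Reached r (opposite z)
      reverse zero ()
      reverse (suc n) {z} ends with next z in eq
      ... | inj₁ r′ rewrite iterate-inj₁ n r′ | inj₁-injective ends = 0 , cong inj₂ (sym (next-final eq))
      ... | inj₂ z′ with reverse n ends
      ...   | m , reached = m + 1 , trans (iterate-+ m 1 _) (trans (cong advance reached) (next-reverse eq))

    -- The fuel F suffices for the runs from all starts, hence (by Ends-Reached) for every run that ends.
    module Bounded (F : ℕ) (start-ends : ∀ r → ∃ λ r′ → iterate F (inj₂ (start r)) ≡ inj₁ r′) where

      outcome : Pos → R ⊎ Pos
      outcome z = iterate F (inj₂ z)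

      outcome-Reached : ∀ {r z} → Reached r z → outcome z ≡ outcome (start r)
      outcome-Reached {r} {z} (m , reached) = begin
        iterate F (inj₂ z)                     ≡⟨ cong (iterate F) reached ⟨
        iterate F (iterate m (inj₂ (start r))) ≡⟨ iterate-comm m F _ ⟩
        iterate m (outcome (start r))          ≡⟨ cong (iterate m) (proj₂ (start-ends r)) ⟩
        iterate m (inj₁ (proj₁ (start-ends r))) ≡⟨ iterate-inj₁ m _ ⟩
        inj₁ (proj₁ (start-ends r))            ≡⟨ proj₂ (start-ends r) ⟨
        outcome (start r)                      ∎
        where open ≡-Reasoning

      -- A position that ends was reached from a start: run backwards from its
      -- end, then forwards again from the end reached that way.
      Ends-Reached : ∀ {z r} → Ends z r → ∃ λ r₀ → Reached r₀ z
      Ends-Reached {z} {r} ends = r₁ , subst (Reached r₁) (opposite-involutive z) (Ends-reverse (F , opposite-ends))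
        where
        r₁ = proj₁ (start-ends r)
        opposite-ends : outcome (opposite z) ≡ inj₁ r₁
        opposite-ends = trans (outcome-Reached (Ends-reverse ends)) (proj₂ (start-ends r))

      outcome-Ends : ∀ {z r} → Ends z r → outcome z ≡ inj₁ r
      outcome-Ends {z} ends = trans ends-in-time (cong inj₁ (sym (Ends-functional ends (F , ends-in-time))))
        where
        r₀ = proj₁ (Ends-Reached ends)
        ends-in-time : outcome z ≡ inj₁ (proj₁ (start-ends r₀))
        ends-in-time = trans (outcome-Reached (proj₂ (Ends-Reached ends))) (proj₂ (start-ends r₀))

      module Colouring {C : Set} (c : R → C) (c-respects : ∀ {r r′} → Ends (start r) r′ → c r ≡ c r′)
                       (default : C) where

        colour : Pos → C
        colour z = [ c , const default ]′ (outcome z)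

        colour-Ends : ∀ {z r} → Ends z r → colour z ≡ c r
        colour-Ends ends = cong [ c , const default ]′ (outcome-Ends ends)

        colour-start : ∀ r → colour (start r) ≡ c r
        colour-start r = trans (colour-Ends (F , proj₂ (start-ends r))) (sym (c-respects (F , proj₂ (start-ends r))))

        -- Positions that never end all get the default colour.
        colour-≡ : ∀ {z z′} → (∀ {r} → Ends z r → colour z ≡ colour z′) →
                   (∀ {r} → Ends z′ r → colour z ≡ colour z′) → colour z ≡ colour z′
        colour-≡ {z} {z′} from-z from-z′ with outcome z in eq | outcome z′ in eq′
        ... | inj₁ r | _      = from-z (F , eq)
        ... | inj₂ _ | inj₁ r = from-z′ (F , eq′)
        ... | inj₂ _ | inj₂ _ = refl

        colour-opposite-Ends : ∀ {z r} → Ends z r → colour (opposite z) ≡ colour z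
        colour-opposite-Ends {z} {r} ends = begin
          colour (opposite z)      ≡⟨ cong [ c , const default ]′ (outcome-Reached (Ends-reverse ends)) ⟩
          colour (start r)  ≡⟨ colour-start r ⟩
          c r               ≡⟨ colour-Ends ends ⟨
          colour z          ∎
          where open ≡-Reasoning

        colour-opposite : ∀ z → colour (opposite z) ≡ colour z
        colour-opposite z = colour-≡
          (λ ends → sym (trans (cong colour (sym (opposite-involutive z))) (colour-opposite-Ends ends)))
          colour-opposite-Ends

        colour-next : ∀ {z z′} → next z ≡ inj₂ z′ → colour z ≡ colour z′
        colour-next eq = colour-≡ (λ ends → trans (colour-Ends ends) (sym (colour-Ends (Ends-next⁻ eq ends))))
                                  (λ ends → trans (colour-Ends (Ends-next⁺ eq ends)) (sym (colour-Ends ends)))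

module Superposition (G : CubicGraph) (Vs : Fin (nV G) → Multipole 3) (Es : Fin (nE G) → Multipole 2)
                     (H : CubicGraph) (S : IsSuperposition G Vs Es H) where
  open Superpose G Vs Es hiding (IsSuperposition)
  open IsSuperposition S

  attachment : Fin (nE G) → Fin 2 → VEnd (nV G)
  attachment e k = proj₁ (end-at-vertex G (Inverse.to (inc G) (e , k)))

  to-attachment : ∀ e k → Inverse.to (inc G) (e , k) ≡ inj₁ (attachment e k)
  to-attachment e k = proj₂ (end-at-vertex G (Inverse.to (inc G) (e , k)))

  incidence : VEnd (nV G) → Fin (nE G) × Fin 2
  incidence vi = Inverse.from (inc G) (inj₁ vi)

  to-incidence : ∀ vi → Inverse.to (inc G) (incidence vi) ≡ inj₁ vi
  to-incidence vi = Inverse.strictlyInverseˡ (inc G) (inj₁ vi)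

  attachment-incidence : ∀ vi → attachment (proj₁ (incidence vi)) (proj₂ (incidence vi)) ≡ vi
  attachment-incidence vi = inj₁-injective (trans (sym (to-attachment _ _)) (to-incidence vi))

  Semiedge : Set
  Semiedge = Σ Piece PSemi

  partner : Semiedge → Semiedge
  partner (inj₂ e , k , j) =
    inj₁ (proj₁ (attachment e k)) , proj₂ (attachment e k) , cast (widths e k _ _ (to-attachment e k)) j
  partner (inj₁ v , i , j) =
    inj₂ (proj₁ (incidence (v , i))) , proj₂ (incidence (v , i)) ,
    cast (sym (widths _ _ v i (to-incidence (v , i)))) j

  Joined′ : Semiedge → Semiedge → Set
  Joined′ (p , s) (q , t) = Joined p s q t

  Joined-partner : ∀ u → Joined′ u (partner u)
  Joined-partner (inj₂ e , k , j) = ev e k j _ _ _ (to-attachment e k) (sym (toℕ-cast _ j))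
  Joined-partner (inj₁ v , i , j) = ve _ _ _ v i j (to-incidence (v , i)) (toℕ-cast _ j)

  Joined-sym : ∀ {u u′} → Joined′ u u′ → Joined′ u′ u
  Joined-sym (ev e k j v i j′ attached same) = ve e k j v i j′ attached same
  Joined-sym (ve e k j v i j′ attached same) = ev e k j v i j′ attached same

  partner-unique : ∀ {u u′} → Joined′ u u′ → partner u ≡ u′
  partner-unique (ev e k j v i j′ attached same)
    with refl ← inj₁-injective (trans (sym (to-attachment e k)) attached)
    = cong (λ j → inj₁ v , i , j) (toℕ-injective (trans (toℕ-cast _ j) same))
  partner-unique (ve e k j v i j′ attached same)
    with refl ← trans (cong (Inverse.from (inc G)) (sym attached)) (Inverse.strictlyInverseʳ (inc G) (e , k))
    = cong (λ j → inj₂ e , k , j) (toℕ-injective (trans (toℕ-cast _ j′) (sym same)))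

  partner-involutive : ∀ u → partner (partner u) ≡ u
  partner-involutive u = partner-unique (Joined-sym (Joined-partner u))

  -- A position (p , x) stands for traversing an edge of the piece p starting from its end x.
  Position : Set
  Position = Σ Piece (λ p → End (piece p))

  PieceVEnd : Set
  PieceVEnd = PVert × Fin 3

  opposite : Position → Position
  opposite (p , x) = p , other (piece p) x

  start : PieceVEnd → Position
  start ((p , w) , i) = p , inj₁ (w , i)

  semiedge : Semiedge → Position
  semiedge (p , s) = p , inj₂ s

  leave : (p : Piece) → End (piece p) → PieceVEnd ⊎ Position
  leave p (inj₁ (w , i)) = inj₁ ((p , w) , i)
  leave p (inj₂ s)       = inj₂ (semiedge (partner (p , s)))

  next : Position → PieceVEnd ⊎ Position
  next (p , x) = leave p (other (piece p) x)

  opposite-involutive : ∀ z → opposite (opposite z) ≡ z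
  opposite-involutive (p , x) = cong (p ,_) (other-involutive (piece p) x)

  next-final : ∀ {z r} → next z ≡ inj₁ r → opposite z ≡ start r
  next-final {p , x} eq with other (piece p) x | eq
  ... | inj₁ (w , i) | refl = refl
  ... | inj₂ s       | ()

  next-opposite-semiedge : ∀ u → next (opposite (semiedge u)) ≡ inj₂ (semiedge (partner u))
  next-opposite-semiedge (p , s) = cong (leave p) (other-involutive (piece p) (inj₂ s))

  next-reverse : ∀ {z z′} → next z ≡ inj₂ z′ → next (opposite z′) ≡ inj₂ (opposite z)
  next-reverse {p , x} eq with other (piece p) x | eq
  ... | inj₁ _ | ()
  ... | inj₂ s | refl = trans (next-opposite-semiedge (partner (p , s)))
                              (cong (inj₂ ∘ semiedge) (partner-involutive (p , s)))

  open Tracing next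
  open Reversible opposite opposite-involutive start next-final next-reverse

  Trace→Ends : ∀ {p x b i} → Trace p x b i → Ends (p , x) (b , i)
  Trace→Ends {p} (stop at-vertex)           = 1 , cong (leave p) at-vertex
  Trace→Ends {p} (step at-semi joined rest) =
    Ends-next⁺ (trans (cong (leave p) at-semi) (cong (inj₂ ∘ semiedge) (partner-unique joined)))
               (Trace→Ends rest)

  Ends→Trace : ∀ {p x b i} → Ends (p , x) (b , i) → Trace p x b i
  Ends→Trace (n , ends) = trace n ends
    where
    trace : ∀ n {p x b i} → iterate n (inj₂ (p , x)) ≡ inj₁ (b , i) → Trace p x b i
    trace zero ()
    trace (suc n) {p} {x} ends with other (piece p) x in at
    ... | inj₁ (w , i) rewrite iterate-inj₁ n ((p , w) , i) with refl ← ends = stop at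
    ... | inj₂ s = step at (Joined-partner (p , s)) (trace n ends)

  toH : PieceVEnd → VEnd (nV H)
  toH (b , j) = Inverse.from ψ b , Inverse.from (π (Inverse.from ψ b)) j

  fromH : VEnd (nV H) → PieceVEnd
  fromH (x , i) = Inverse.to ψ x , Inverse.to (π x) i

  fromH-toH : ∀ r → fromH (toH r) ≡ r
  fromH-toH (b , j) = cong₂ _,_ (Inverse.strictlyInverseˡ ψ b) (Inverse.strictlyInverseˡ (π (Inverse.from ψ b)) j)

  adjacent→Ends : ∀ r y → other H (inj₁ (toH r)) ≡ inj₁ y → Ends (start r) (fromH y)
  adjacent→Ends r (y , j) adjacent =
    subst (λ r → Ends (start r) (fromH (y , j))) (fromH-toH r)
          (Trace→Ends (Equivalence.to (edges _ _ y j) adjacent))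

  Ends→adjacent : ∀ {r r′} → Ends (start r) r′ → other H (inj₁ (toH r)) ≡ inj₁ (toH r′)
  Ends→adjacent {r} {r′} ends = Equivalence.from (edges _ _ _ _)
    (subst₂ (λ (b , j) (b′ , j′) → Chain b j b′ j′) (sym (fromH-toH r)) (sym (fromH-toH r′))
            (Ends→Trace ends))

  start-Ends : ∀ r → ∃ λ r′ → Ends (start r) r′
  start-Ends r = fromH y , adjacent→Ends r y adjacent
    where
    y = proj₁ (end-at-vertex H (other H (inj₁ (toH r))))
    adjacent = proj₂ (end-at-vertex H (other H (inj₁ (toH r))))

  steps : VEnd (nV H) → ℕ
  steps h = proj₁ (proj₂ (start-Ends (fromH h)))

  steps-bounded : ∃ λ fuel → ∀ h → steps h ≤ fuel
  steps-bounded = bounded-↔ (Semi-↔ (nV H) (λ _ → 3)) steps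

  fuel : ℕ
  fuel = proj₁ steps-bounded

  start-Ends-within-fuel : ∀ r → ∃ λ r′ → iterate fuel (inj₂ (start r)) ≡ inj₁ r′
  start-Ends-within-fuel r = subst (λ r → ∃ λ r′ → iterate fuel (inj₂ (start r)) ≡ inj₁ r′) (fromH-toH r)
    (_ , iterate-mono (proj₂ steps-bounded (toH r)) (proj₂ (proj₂ (start-Ends (fromH (toH r))))))

  open Bounded fuel start-Ends-within-fuel

  module PullBack (col : Fin (nE H) → K) where

    colourH : PieceVEnd → K
    colourH r = col (edgeAt H (inj₁ (toH r)))

    colourH-respects : ∀ {r r′} → Ends (start r) r′ → colourH r ≡ colourH r′
    colourH-respects {r} ends =
      cong col (trans (sym (edgeAt-other H (inj₁ (toH r)))) (cong (edgeAt H) (Ends→adjacent ends)))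

    -- Positions on closed cycles of isolated edges never reach a vertex; any colour will do there.
    default : K
    default = (true , false) , λ ()

    open Colouring colourH colourH-respects default

    pieceColouring : (p : Piece) → Fin (nE (piece p)) → K
    pieceColouring p = edgeColouring (piece p) (λ x → colour (p , x)) (λ x → colour-opposite (p , x))

    pieceColouring-edgeAt : ∀ p x → pieceColouring p (edgeAt (piece p) x) ≡ colour (p , x)
    pieceColouring-edgeAt p = edgeColouring-edgeAt (piece p) (λ x → colour (p , x)) (λ x → colour-opposite (p , x))

    pieceColouring-VertexOK : ∀ p w → VertexOK H col (Inverse.from ψ (p , w)) →
                              VertexOK (piece p) (pieceColouring p) w
    pieceColouring-VertexOK p w kirchhoff = begin
      sumZ 3 (λ i → proj₁ (pieceColouring p (edgeAt (piece p) (inj₁ (w , i)))))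
        ≡⟨ sumZ-cong 3 (λ i → cong proj₁ (trans (pieceColouring-edgeAt p _) (colour-start ((p , w) , i)))) ⟩
      sumZ 3 (λ i → colourAt (Inverse.from (π x) i))
        ≡⟨ sumZ-permute (↔-sym (π x)) colourAt ⟨
      sumZ 3 colourAt
        ≡⟨ kirchhoff ⟩
      0ᶻ ∎
      where
      open ≡-Reasoning
      x = Inverse.from ψ (p , w)
      colourAt : Fin 3 → Z22
      colourAt i = proj₁ (col (edgeAt H (inj₁ (x , i))))

    flow-pieceColouring : ∀ p i → flow (piece p) (pieceColouring p) i ≡
                          sumZ (width (piece p) i) (λ j → proj₁ (colour (semiedge (p , i , j))))
    flow-pieceColouring p i = sumZ-cong _ (λ j → cong proj₁ (pieceColouring-edgeAt p (inj₂ (i , j))))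

    colour-partner : ∀ u → colour (semiedge (partner u)) ≡ colour (semiedge u)
    colour-partner u = trans (sym (colour-next (next-opposite-semiedge u))) (colour-opposite (semiedge u))

    flow-junction : ∀ e k → let (v , i) = attachment e k in
                    flow (Es e) (pieceColouring (inj₂ e)) k ≡ flow (Vs v) (pieceColouring (inj₁ v)) i
    flow-junction e k = begin
      flow (Es e) (pieceColouring (inj₂ e)) k
        ≡⟨ flow-pieceColouring (inj₂ e) k ⟩
      sumZ (width (Es e) k) (λ j → proj₁ (colour (semiedge (inj₂ e , k , j))))
        ≡⟨ sumZ-cong _ (λ j → cong proj₁ (colour-partner (inj₂ e , k , j))) ⟨
      sumZ (width (Es e) k) (λ j → proj₁ (colour (semiedge (partner (inj₂ e , k , j)))))
        ≡⟨ sumZ-cast (widths e k v i (to-attachment e k)) (λ j → proj₁ (colour (semiedge (inj₁ v , i , j)))) ⟩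
      sumZ (width (Vs v) i) (λ j → proj₁ (colour (semiedge (inj₁ v , i , j))))
        ≡⟨ flow-pieceColouring (inj₁ v) i ⟨
      flow (Vs v) (pieceColouring (inj₁ v)) i ∎
      where
      open ≡-Reasoning
      v = proj₁ (attachment e k)
      i = proj₂ (attachment e k)

  ψ-from-injective : ∀ {b b′} → Inverse.from ψ b ≡ Inverse.from ψ b′ → b ≡ b′
  ψ-from-injective = Injection.injective (↔⇒↣ (↔-sym ψ))

  supervertices-disjoint : ∀ {u v} {x : Fin (nV (Vs u))} {y : Fin (nV (Vs v))} → u ≢ v →
                           Inverse.from ψ (inj₁ u , x) ≢ Inverse.from ψ (inj₁ v , y)
  supervertices-disjoint u≢v = u≢v ∘ inj₁-injective ∘ cong proj₁ ∘ ψ-from-injective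

  superedge-supervertex-disjoint : ∀ {e u} {w : Fin (nV (Es e))} {x : Fin (nV (Vs u))} →
                                   Inverse.from ψ (inj₂ e , w) ≢ Inverse.from ψ (inj₁ u , x)
  superedge-supervertex-disjoint = (λ ()) ∘ cong proj₁ ∘ ψ-from-injective

  base-Colourable-6pole : (∀ e → ProperSuperedge (Es e)) →
                          ∀ {u v} (x : Fin (nV (Vs u))) (y : Fin (nV (Vs v))) →
                          Colourable-6pole H (Inverse.from ψ (inj₁ u , x)) (Inverse.from ψ (inj₁ v , y)) →
                          Colourable-6pole G u v
  base-Colourable-6pole proper {u} {v} x y (col , kirchhoff) = colourG , colourG-VertexOK
    where
    open PullBack col

    superedge-coloured : ∀ e → IsColouring (Es e) (pieceColouring (inj₂ e))
    superedge-coloured e w = pieceColouring-VertexOK (inj₂ e) w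
      (kirchhoff _ superedge-supervertex-disjoint superedge-supervertex-disjoint)

    supervertex-coloured : ∀ w → w ≢ u → w ≢ v → IsColouring (Vs w) (pieceColouring (inj₁ w))
    supervertex-coloured w w≢u w≢v z = pieceColouring-VertexOK (inj₁ w) z
      (kirchhoff _ (supervertices-disjoint w≢u) (supervertices-disjoint w≢v))

    flowE : Fin (nE G) → Fin 2 → Z22
    flowE e = flow (Es e) (pieceColouring (inj₂ e))

    colourG : Fin (nE G) → K
    colourG e = flowE e zero , proper e (pieceColouring (inj₂ e)) (superedge-coloured e) zero

    flowE-any-end : ∀ e k → flowE e zero ≡ flowE e k
    flowE-any-end e zero       = refl
    flowE-any-end e (suc zero) = flow-parity-2 (Es e) (pieceColouring (inj₂ e)) (superedge-coloured e)

    colourG-VertexOK : ∀ w → w ≢ u → w ≢ v → VertexOK G colourG w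
    colourG-VertexOK w w≢u w≢v = begin
      sumZ 3 (λ i → flowE (proj₁ (incidence (w , i))) zero)
        ≡⟨ sumZ-cong 3 flow-through-incidence ⟩
      sumZ 3 (flow (Vs w) (pieceColouring (inj₁ w)))
        ≡⟨ flow-parity (Vs w) (pieceColouring (inj₁ w)) (supervertex-coloured w w≢u w≢v) ⟩
      0ᶻ ∎
      where
      open ≡-Reasoning
      flow-through-incidence : ∀ i → flowE (proj₁ (incidence (w , i))) zero ≡
                                     flow (Vs w) (pieceColouring (inj₁ w)) i
      flow-through-incidence i = begin
        flowE e zero  ≡⟨ flowE-any-end e k ⟩
        flowE e k     ≡⟨ flow-junction e k ⟩
        flow (Vs (proj₁ (attachment e k))) (pieceColouring (inj₁ (proj₁ (attachment e k)))) (proj₂ (attachment e k))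
          ≡⟨ cong (λ (v , i) → flow (Vs v) (pieceColouring (inj₁ v)) i) (attachment-incidence (w , i)) ⟩
        flow (Vs w) (pieceColouring (inj₁ w)) i ∎
        where
        e = proj₁ (incidence (w , i))
        k = proj₂ (incidence (w , i))

lemma9 : (G : CubicGraph) (Vs : Fin (nV G) → Multipole 3) (Es : Fin (nE G) → Multipole 2)
         (H : CubicGraph) → Snark G → Snark H →
         (S : IsSuperposition G Vs Es H) → (∀ e → ProperSuperedge (Es e)) →
         ∀ u v → Removable G u v →
         ∀ (x : Fin (nV (Vs u))) (y : Fin (nV (Vs v))) →
         Removable H (Inverse.from (IsSuperposition.ψ S) (inj₁ u , x))
                     (Inverse.from (IsSuperposition.ψ S) (inj₁ v , y))
lemma9 G Vs Es H _ _ S proper u v (u≢v , ¬colourable) x y =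
  supervertices-disjoint u≢v , ¬colourable ∘ base-Colourable-6pole proper x y
  where open Superposition G Vs Es H S
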